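{- For every $k\ge0$ and all $n,p\ge 3^k$, $\mathfrak{A}_n^+\equiv_k\mathfrak{A}_p^+$.
   Context: For $n\ge1$, $\mathfrak{A}_n^+$ is the structure over vocabulary $\{\subseteq,\textsc{Pos}\}$ with domain $\{0,1,\bot\}^n$, where $\subseteq$ is the subsumption relation ($\mathbf{e}_1\subseteq\mathbf{e}_2$ iff $\mathbf{e}_1[i]=\mathbf{e}_2[i]$ for every $i$ with $\mathbf{e}_1[i]\neq\bot$) and $\textsc{Pos}$ contains only the tuple $\{1\}^n$. $\mathfrak{A}\equiv_k\mathfrak{B}$ means the duplicator wins the $k$-round Ehrenfeucht–Fraïssé game on $\mathfrak{A},\mathfrak{B}$, equivalently they agree on all first-order sentences of quantifier rank at most $k$. -}

module Defs where

open import Data.Nat using (ℕ; zero; suc)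
open import Data.Fin using (Fin)
open import Data.Vec using (Vec; []; _∷_; lookup; replicate)
open import Data.Product using (_×_; Σ)
open import Relation.Binary.PropositionalEquality using (_≡_)
open import Relation.Nullary using (¬_)
open import Function.Bundles using (_⇔_)

data Tri : Set where
  𝟘 𝟙 ⊥ₜ : Tri

_⊑_ : {n : ℕ} → Vec Tri n → Vec Tri n → Set
_⊑_ {n} e₁ e₂ = (i : Fin n) → ¬ (lookup e₁ i ≡ ⊥ₜ) → lookup e₁ i ≡ lookup e₂ i

record Structure : Set₁ where
  field
    Carrier : Set
    Sub     : Carrier → Carrier → Set
    Pos     : Carrier → Set
open Structure public

𝔄⁺ : ℕ → Structure
𝔄⁺ n = record
  { Carrier = Vec Tri n
  ; Sub     = _⊑_
  ; Pos     = λ e → e ≡ replicate n 𝟙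
  }

PartialIso : (𝔄 𝔅 : Structure) {m : ℕ} → Vec (Carrier 𝔄) m → Vec (Carrier 𝔅) m → Set
PartialIso 𝔄 𝔅 {m} a b =
  ((i j : Fin m) → (lookup a i ≡ lookup a j) ⇔ (lookup b i ≡ lookup b j))
  × ((i j : Fin m) → Sub 𝔄 (lookup a i) (lookup a j) ⇔ Sub 𝔅 (lookup b i) (lookup b j))
  × ((i : Fin m) → Pos 𝔄 (lookup a i) ⇔ Pos 𝔅 (lookup b i))

DupWins : (𝔄 𝔅 : Structure) (k : ℕ) {m : ℕ} → Vec (Carrier 𝔄) m → Vec (Carrier 𝔅) m → Set
DupWins 𝔄 𝔅 zero    a b = PartialIso 𝔄 𝔅 a b
DupWins 𝔄 𝔅 (suc k) a b =
  ((x : Carrier 𝔄) → Σ (Carrier 𝔅) λ y → DupWins 𝔄 𝔅 k (x ∷ a) (y ∷ b))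
  × ((y : Carrier 𝔅) → Σ (Carrier 𝔄) λ x → DupWins 𝔄 𝔅 k (x ∷ a) (y ∷ b))

_≡[_]_ : Structure → ℕ → Structure → Set
𝔄 ≡[ k ] 𝔅 = DupWins 𝔄 𝔅 k [] []

-- A position (ā, b̄) with m pebbled tuples is best read column by column: coordinate c of 𝔄ₙ⁺
-- contributes the column (ā₁[c], …, āₘ[c]) ∈ {0,1,⊥}ᵐ. Equality, subsumption and Pos are all
-- checked coordinatewise, so the position is a partial isomorphism as soon as both sides have the
-- same set of columns. With k rounds left, Duplicator keeps every column occurring equally often on
-- both sides, or at least 3ᵏ times on each. A new tuple splits the class of each column into three
-- classes by its new entry; if the class has at least 3ᵏ⁺¹ members on both sides, one of Spoiler's
-- three parts has at least 3ᵏ members, so Duplicator can split her class into three parts matching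
-- Spoiler's up to threshold 3ᵏ, and any such split is realised by some answer tuple.
-- Initially the empty column occurs n resp. p times.
module Submission where

open import Defs
open import Data.Nat using (ℕ; _≤_; _^_)
open import Data.Nat using (zero; suc; _+_; _*_; _∸_; _⊓_; _<_; _≤?_; _<?_; z≤n; s≤s)
open import Data.Nat.Properties
open import Data.Nat.Solver using (module +-*-Solver)
open import Data.Bool using (if_then_else_)
open import Data.Fin using (Fin; zero; suc)
open import Data.Vec using (Vec; []; _∷_; lookup; replicate; map; tabulate)
open import Data.Vec.Properties using (≡-dec; lookup-map; lookup-replicate; lookup∘tabulate)
open import Data.Vec.Relation.Binary.Pointwise.Extensional using (ext; Pointwise-≡↔≡)
  renaming (module Pointwise to Pointwise-ext)
open import Data.Vec.Functional using (Vector; head; tail; zipWith)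
open import Data.Product using (Σ; ∃; ∃₂; _×_; _,_; proj₁; proj₂)
open import Data.Sum using (_⊎_; inj₁; inj₂)
open import Data.Empty using (⊥-elim)
open import Relation.Binary.Definitions using (DecidableEquality)
open import Relation.Binary.PropositionalEquality
open import Relation.Nullary using (¬_; yes; no; does)
open import Function using (_∘_)
open import Function.Bundles using (_⇔_; mk⇔)
open import Function.Properties.Equivalence using () renaming (sym to ⇔-sym; trans to ⇔-trans)

private
  variable
    m n p : ℕ
    K : ℕ

_≟ₜ_ : DecidableEquality Tri
𝟘 ≟ₜ 𝟘 = yes refl
𝟘 ≟ₜ 𝟙 = no λ ()
𝟘 ≟ₜ ⊥ₜ = no λ ()
𝟙 ≟ₜ 𝟘 = no λ ()
𝟙 ≟ₜ 𝟙 = yes refl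
𝟙 ≟ₜ ⊥ₜ = no λ ()
⊥ₜ ≟ₜ 𝟘 = no λ ()
⊥ₜ ≟ₜ 𝟙 = no λ ()
⊥ₜ ≟ₜ ⊥ₜ = yes refl

_≟ᶜ_ : DecidableEquality (Vec Tri m)
_≟ᶜ_ = ≡-dec _≟ₜ_

-- Defined through `does`, so that δ (v ∷ a) (w ∷ b) computes to δ a b or 0 for concrete v, w.
δ : Vec Tri m → Vec Tri m → ℕ
δ s t = if does (s ≟ᶜ t) then 1 else 0

δ-refl : (t : Vec Tri m) → δ t t ≡ 1
δ-refl t with t ≟ᶜ t
... | yes _ = refl
... | no t≢t = ⊥-elim (t≢t refl)

δ≤ : (β : Vec Tri m → ℕ) (s : Vec Tri m) → 0 < β s → ∀ t → δ s t ≤ β t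
δ≤ β s β>0 t with s ≟ᶜ t
... | yes refl = β>0
... | no _ = z≤n

sumTri : (Tri → ℕ) → ℕ
sumTri h = h 𝟘 + (h 𝟙 + h ⊥ₜ)

sumTri-cong : {h h′ : Tri → ℕ} → (∀ v → h v ≡ h′ v) → sumTri h ≡ sumTri h′
sumTri-cong eq = cong₂ _+_ (eq 𝟘) (cong₂ _+_ (eq 𝟙) (eq ⊥ₜ))

sumTri-+ : (h h′ : Tri → ℕ) → sumTri (λ v → h v + h′ v) ≡ sumTri h + sumTri h′
sumTri-+ h h′ = solve 6 (λ a b c a′ b′ c′ →
    (a :+ a′) :+ ((b :+ b′) :+ (c :+ c′)) := (a :+ (b :+ c)) :+ (a′ :+ (b′ :+ c′)))
  refl (h 𝟘) (h 𝟙) (h ⊥ₜ) (h′ 𝟘) (h′ 𝟙) (h′ ⊥ₜ)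
  where open +-*-Solver

sumTri≡0 : (h : Tri → ℕ) → sumTri h ≡ 0 → ∀ v → h v ≡ 0
sumTri≡0 h eq 𝟘 = m+n≡0⇒m≡0 (h 𝟘) eq
sumTri≡0 h eq 𝟙 = m+n≡0⇒m≡0 (h 𝟙) (m+n≡0⇒n≡0 (h 𝟘) eq)
sumTri≡0 h eq ⊥ₜ = m+n≡0⇒n≡0 (h 𝟙) (m+n≡0⇒n≡0 (h 𝟘) eq)

sumTri>0 : (h : Tri → ℕ) → 0 < sumTri h → ∃ λ v → 0 < h v
sumTri>0 h sum>0 with 0 <? h 𝟘 | 0 <? h 𝟙 | 0 <? h ⊥ₜ
... | yes h𝟘>0 | _ | _ = 𝟘 , h𝟘>0
... | no _ | yes h𝟙>0 | _ = 𝟙 , h𝟙>0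
... | no _ | no _ | yes h⊥>0 = ⊥ₜ , h⊥>0
... | no h𝟘≯0 | no h𝟙≯0 | no h⊥≯0 =
  ⊥-elim (<⇒≱ sum>0 (+-mono-≤ (≮⇒≥ h𝟘≯0) (+-mono-≤ (≮⇒≥ h𝟙≯0) (≮⇒≥ h⊥≯0))))

sumTri-δ-∷ : (v : Tri) (a b : Vec Tri m) → sumTri (λ w → δ (v ∷ a) (w ∷ b)) ≡ δ a b
sumTri-δ-∷ 𝟘 a b = +-identityʳ (δ a b)
sumTri-δ-∷ 𝟙 a b = +-identityʳ (δ a b)
sumTri-δ-∷ ⊥ₜ a b = refl

count : Vector (Vec Tri m) n → Vec Tri m → ℕ
count {n = zero} f t = 0
count {n = suc n} f t = δ (head f) t + count (tail f) t

count-cong : {f g : Vector (Vec Tri m) n} → (∀ c → f c ≡ g c) → ∀ t → count f t ≡ count g t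
count-cong {n = zero} f≗g t = refl
count-cong {n = suc n} f≗g t = cong₂ _+_ (cong (λ s → δ s t) (f≗g zero)) (count-cong (f≗g ∘ suc) t)

count-const : (t : Vec Tri m) → count {n = n} (λ _ → t) t ≡ n
count-const {n = zero} t = refl
count-const {n = suc n} t = cong₂ _+_ (δ-refl t) (count-const t)

count-self : (f : Vector (Vec Tri m) n) (c : Fin n) → 0 < count f (f c)
count-self f zero rewrite δ-refl (f zero) = s≤s z≤n
count-self f (suc c) = <-≤-trans (count-self (tail f) c) (m≤n+m _ _)

count>0⇒∈ : (f : Vector (Vec Tri m) n) (t : Vec Tri m) → 0 < count f t → ∃ λ c → f c ≡ t
count>0⇒∈ {n = suc n} f t count>0 with head f ≟ᶜ t
... | yes f₀≡t = zero , f₀≡t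
... | no _ = let c , fc≡t = count>0⇒∈ (tail f) t count>0 in suc c , fc≡t

count-zipWith-∷ : (x : Vector Tri n) (f : Vector (Vec Tri m) n) (t : Vec Tri m) →
  sumTri (λ v → count (zipWith _∷_ x f) (v ∷ t)) ≡ count f t
count-zipWith-∷ {n = zero} x f t = refl
count-zipWith-∷ {n = suc n} x f t =
  trans (sumTri-+ (λ v → δ (head x ∷ head f) (v ∷ t)) (λ v → count (zipWith _∷_ (tail x) (tail f)) (v ∷ t)))
        (cong₂ _+_ (sumTri-δ-∷ (head x) (head f) t) (count-zipWith-∷ (tail x) (tail f) t))

Close : ℕ → ℕ → ℕ → Set
Close K x y = x ≡ y ⊎ (K ≤ x × K ≤ y)

Close-sym : ∀ {x y} → Close K x y → Close K y x
Close-sym (inj₁ x≡y) = inj₁ (sym x≡y)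
Close-sym (inj₂ (K≤x , K≤y)) = inj₂ (K≤y , K≤x)

Close-pos : ∀ {x y} → Close (suc K) x y → 0 < y → 0 < x
Close-pos (inj₁ refl) y>0 = y>0
Close-pos (inj₂ (sK≤x , _)) _ = <-≤-trans (s≤s z≤n) sK≤x

Close-⊓ : ∀ x → Close K x (x ⊓ K)
Close-⊓ {K} x with x ≤? K
... | yes x≤K = inj₁ (sym (m≤n⇒m⊓n≡m x≤K))
... | no x≰K = inj₂ (≰⇒≥ x≰K , ≤-reflexive (sym (m≥n⇒m⊓n≡n (≰⇒≥ x≰K))))

-- If a ≥ K, take b ⊓ L for the second part and let the first absorb the rest of N;
-- otherwise b ≥ L, so keep a′ = a and let the second part absorb the rest.
Close-split : ∀ K L {a b N} → Close (K + L) (a + b) N →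
  ∃₂ λ a′ b′ → a′ + b′ ≡ N × Close K a a′ × Close L b b′
Close-split K L {a} {b} (inj₁ refl) = a , b , refl , inj₁ refl , inj₁ refl
Close-split K L {a} {b} {N} (inj₂ (K+L≤a+b , K+L≤N)) with K ≤? a
... | yes K≤a = N ∸ (b ⊓ L) , b ⊓ L , m∸n+n≡m b⊓L≤N , inj₂ (K≤a , K≤N∸b⊓L) , Close-⊓ b
  where
    K+b⊓L≤N : K + b ⊓ L ≤ N
    K+b⊓L≤N = ≤-trans (+-monoʳ-≤ K (m⊓n≤n b L)) K+L≤N
    b⊓L≤N : b ⊓ L ≤ N
    b⊓L≤N = m+n≤o⇒n≤o K K+b⊓L≤N
    K≤N∸b⊓L : K ≤ N ∸ b ⊓ L
    K≤N∸b⊓L = m+n≤o⇒m≤o∸n K K+b⊓L≤N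
... | no K≰a = a , N ∸ a , m+[n∸m]≡n a≤N , inj₁ refl , inj₂ (L≤b , L≤N∸a)
  where
    a<K : a < K
    a<K = ≰⇒> K≰a
    L≤b : L ≤ b
    L≤b = ≮⇒≥ (λ b<L → <⇒≱ (+-mono-< a<K b<L) K+L≤a+b)
    a+L≤N : a + L ≤ N
    a+L≤N = ≤-trans (+-monoˡ-≤ L (<⇒≤ a<K)) K+L≤N
    a≤N : a ≤ N
    a≤N = m+n≤o⇒m≤o a a+L≤N
    L≤N∸a : L ≤ N ∸ a
    L≤N∸a = m+n≤o⇒m≤o∸n L (subst (_≤ N) (+-comm a L) a+L≤N)

-- 3 * K unfolds to K + (K + (K + 0)), matching the shape of sumTri.
Close-split₃ : ∀ K {h N} → Close (3 * K) (sumTri h) N →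
  Σ (Tri → ℕ) λ h′ → sumTri h′ ≡ N × (∀ v → Close K (h v) (h′ v))
Close-split₃ K {h} close with Close-split K (K + (K + 0)) close
... | z , r , z+r≡N , close𝟘 , close-rest with Close-split K (K + 0) close-rest
... | o , u , o+u≡r , close𝟙 , close⊥ = h′ , trans (cong (z +_) o+u≡r) z+r≡N , close-h′
  where
    h′ : Tri → ℕ
    h′ 𝟘 = z
    h′ 𝟙 = o
    h′ ⊥ₜ = u
    close-h′ : ∀ v → Close K (h v) (h′ v)
    close-h′ 𝟘 = close𝟘
    close-h′ 𝟙 = close𝟙
    close-h′ ⊥ₜ = subst (λ L → Close L (h ⊥ₜ) u) (+-identityʳ K) close⊥

-- The first column g₀ is extended by an entry v with β (v ∷ g₀) > 0, and the remaining columns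
-- realise β minus the indicator of v ∷ g₀.
realise : (g : Vector (Vec Tri m) p) (β : Vec Tri (suc m) → ℕ) →
  (∀ t → sumTri (λ v → β (v ∷ t)) ≡ count g t) →
  Σ (Vector Tri p) λ y → ∀ s → count (zipWith _∷_ y g) s ≡ β s
realise {p = zero} g β refines = (λ ()) , λ { (v ∷ t) → sym (sumTri≡0 (λ w → β (w ∷ t)) (refines t) v) }
realise {m} {suc p} g β refines = y , realised
  where
    g₀ : Vec Tri m
    g₀ = head g
    chosen : ∃ λ v → 0 < β (v ∷ g₀)
    chosen = sumTri>0 (λ v → β (v ∷ g₀)) (subst (0 <_) (sym (refines g₀)) (count-self g zero))
    v : Tri
    v = proj₁ chosen
    β′ : Vec Tri (suc m) → ℕ
    β′ s = β s ∸ δ (v ∷ g₀) s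
    δ+β′≡β : ∀ s → δ (v ∷ g₀) s + β′ s ≡ β s
    δ+β′≡β s = m+[n∸m]≡n (δ≤ β (v ∷ g₀) (proj₂ chosen) s)
    refines′ : ∀ t → sumTri (λ w → β′ (w ∷ t)) ≡ count (tail g) t
    refines′ t = +-cancelˡ-≡ (δ g₀ t) _ _ (begin
      δ g₀ t + sumTri (λ w → β′ (w ∷ t))
        ≡⟨ cong (_+ sumTri (λ w → β′ (w ∷ t))) (sumTri-δ-∷ v g₀ t) ⟨
      sumTri (λ w → δ (v ∷ g₀) (w ∷ t)) + sumTri (λ w → β′ (w ∷ t))
        ≡⟨ sumTri-+ (λ w → δ (v ∷ g₀) (w ∷ t)) (λ w → β′ (w ∷ t)) ⟨
      sumTri (λ w → δ (v ∷ g₀) (w ∷ t) + β′ (w ∷ t))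
        ≡⟨ sumTri-cong (λ w → δ+β′≡β (w ∷ t)) ⟩
      sumTri (λ w → β (w ∷ t))
        ≡⟨ refines t ⟩
      δ g₀ t + count (tail g) t ∎)
      where open ≡-Reasoning
    rest : Σ (Vector Tri p) λ y → ∀ s → count (zipWith _∷_ y (tail g)) s ≡ β′ s
    rest = realise (tail g) β′ refines′
    y : Vector Tri (suc p)
    y zero = v
    y (suc c) = proj₁ rest c
    realised : ∀ s → count (zipWith _∷_ y g) s ≡ β s
    realised s = trans (cong (δ (v ∷ g₀) s +_) (proj₂ rest s)) (δ+β′≡β s)

CountsClose : ℕ → Vector (Vec Tri m) n → Vector (Vec Tri m) p → Set
CountsClose K f g = ∀ t → Close K (count f t) (count g t)

extend-columns : {f : Vector (Vec Tri m) n} {g : Vector (Vec Tri m) p} →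
  CountsClose (3 * K) f g → (x : Vector Tri n) →
  ∃ λ y → CountsClose K (zipWith _∷_ x f) (zipWith _∷_ y g)
extend-columns {m} {p = p} {K = K} {f} {g} close x = proj₁ realised , λ s →
  subst (Close K _) (sym (proj₂ realised s)) (close-β s)
  where
    split : ∀ t → Σ (Tri → ℕ) λ h′ →
      sumTri h′ ≡ count g t × (∀ v → Close K (count (zipWith _∷_ x f) (v ∷ t)) (h′ v))
    split t = Close-split₃ K (subst (λ c → Close (3 * K) c (count g t)) (sym (count-zipWith-∷ x f t)) (close t))
    β : Vec Tri (suc m) → ℕ
    β (v ∷ t) = proj₁ (split t) v
    realised : Σ (Vector Tri p) λ y → ∀ s → count (zipWith _∷_ y g) s ≡ β s
    realised = realise g β (λ t → proj₁ (proj₂ (split t)))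
    close-β : ∀ s → Close K (count (zipWith _∷_ x f) s) (β s)
    close-β (v ∷ t) = proj₂ (proj₂ (split t)) v

column : Vec (Vec Tri n) m → Vector (Vec Tri m) n
column a c = map (λ e → lookup e c) a

Similar : ℕ → Vec (Vec Tri n) m → Vec (Vec Tri p) m → Set
Similar K a b = CountsClose K (column a) (column b)

Similar-sym : (a : Vec (Vec Tri n) m) (b : Vec (Vec Tri p) m) → Similar K a b → Similar K b a
Similar-sym a b similar t = Close-sym (similar t)

extend-position : (a : Vec (Vec Tri n) m) (b : Vec (Vec Tri p) m) →
  Similar (3 * K) a b → (x : Vec Tri n) → ∃ λ y → Similar K (x ∷ a) (y ∷ b)
extend-position {K = K} a b similar x =
  let y , similar′ = extend-columns {f = column a} {g = column b} similar (lookup x) in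
  tabulate y , λ s → subst (Close K _) (count-cong (λ d → cong (_∷ column b d) (sym (lookup∘tabulate y d))) s)
                             (similar′ s)

lookup-column : (a : Vec (Vec Tri n) m) (i : Fin m) (c : Fin n) → lookup (column a c) i ≡ lookup (lookup a i) c
lookup-column a i c = lookup-map i (λ e → lookup e c) a

columnwise : (R : Tri → Tri → Set) (a : Vec (Vec Tri n) m) (i j : Fin m) →
  (∀ c → R (lookup (lookup a i) c) (lookup (lookup a j) c)) ⇔
  (∀ c → R (lookup (column a c) i) (lookup (column a c) j))
columnwise R a i j = mk⇔
  (λ r c → subst₂ R (sym (lookup-column a i c)) (sym (lookup-column a j c)) (r c))
  (λ r c → subst₂ R (lookup-column a i c) (lookup-column a j c) (r c))

≡⇔lookup≡ : {u v : Vec Tri n} → u ≡ v ⇔ (∀ c → lookup u c ≡ lookup v c)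
≡⇔lookup≡ = ⇔-trans (⇔-sym Pointwise-≡↔≡) (mk⇔ Pointwise-ext.app ext)

≡⇔columnwise : (a : Vec (Vec Tri n) m) (i j : Fin m) →
  (lookup a i ≡ lookup a j) ⇔ (∀ c → lookup (column a c) i ≡ lookup (column a c) j)
≡⇔columnwise a i j = ⇔-trans ≡⇔lookup≡ (columnwise _≡_ a i j)

⊑⇔columnwise : (a : Vec (Vec Tri n) m) (i j : Fin m) →
  (lookup a i ⊑ lookup a j) ⇔ (∀ c → ¬ lookup (column a c) i ≡ ⊥ₜ → lookup (column a c) i ≡ lookup (column a c) j)
⊑⇔columnwise = columnwise (λ x y → ¬ x ≡ ⊥ₜ → x ≡ y)

≡𝟙ⁿ⇔columnwise : (a : Vec (Vec Tri n) m) (i : Fin m) →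
  (lookup a i ≡ replicate n 𝟙) ⇔ (∀ c → lookup (column a c) i ≡ 𝟙)
≡𝟙ⁿ⇔columnwise {n} a i = ⇔-trans ≡⇔lookup≡ (⇔-trans lookup≡𝟙 (columnwise (λ x _ → x ≡ 𝟙) a i i))
  where
    lookup≡𝟙 : (∀ c → lookup (lookup a i) c ≡ lookup (replicate n 𝟙) c) ⇔ (∀ c → lookup (lookup a i) c ≡ 𝟙)
    lookup≡𝟙 = mk⇔ (λ r c → trans (r c) (lookup-replicate c 𝟙)) (λ r c → trans (r c) (sym (lookup-replicate c 𝟙)))

-- Threshold 1 means that a and b have the same set of columns.
all-columns-transfer : (a : Vec (Vec Tri n) m) (b : Vec (Vec Tri p) m) → Similar 1 a b →
  (P : Vec Tri m → Set) → (∀ c → P (column a c)) → ∀ d → P (column b d)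
all-columns-transfer a b similar P all-a d =
  let c , a-c≡b-d = count>0⇒∈ (column a) (column b d) (Close-pos (similar (column b d)) (count-self (column b) d))
  in subst P a-c≡b-d (all-a c)

similar⇒partialIso : (a : Vec (Vec Tri n) m) (b : Vec (Vec Tri p) m) →
  Similar 1 a b → PartialIso (𝔄⁺ n) (𝔄⁺ p) a b
similar⇒partialIso {m = m} a b similar =
    (λ i j → via (λ t → lookup t i ≡ lookup t j) (≡⇔columnwise a i j) (≡⇔columnwise b i j))
  , (λ i j → via (λ t → ¬ lookup t i ≡ ⊥ₜ → lookup t i ≡ lookup t j) (⊑⇔columnwise a i j) (⊑⇔columnwise b i j))
  , (λ i → via (λ t → lookup t i ≡ 𝟙) (≡𝟙ⁿ⇔columnwise a i) (≡𝟙ⁿ⇔columnwise b i))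
  where
    via : {A B : Set} (P : Vec Tri m → Set) → A ⇔ (∀ c → P (column a c)) → B ⇔ (∀ d → P (column b d)) → A ⇔ B
    via P A⇔ B⇔ = ⇔-trans A⇔ (⇔-trans transfer (⇔-sym B⇔))
      where
        transfer : (∀ c → P (column a c)) ⇔ (∀ d → P (column b d))
        transfer = mk⇔ (all-columns-transfer a b similar P) (all-columns-transfer b a (Similar-sym a b similar) P)

similar⇒dupWins : ∀ k (a : Vec (Vec Tri n) m) (b : Vec (Vec Tri p) m) →
  Similar (3 ^ k) a b → DupWins (𝔄⁺ n) (𝔄⁺ p) k a b
similar⇒dupWins zero a b similar = similar⇒partialIso a b similar
similar⇒dupWins {n} {m} {p} (suc k) a b similar = forth , back
  where
    forth : (x : Vec Tri n) → Σ (Vec Tri p) λ y → DupWins (𝔄⁺ n) (𝔄⁺ p) k (x ∷ a) (y ∷ b)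
    forth x = let y , similar′ = extend-position a b similar x
              in y , similar⇒dupWins k (x ∷ a) (y ∷ b) similar′
    back : (y : Vec Tri p) → Σ (Vec Tri n) λ x → DupWins (𝔄⁺ n) (𝔄⁺ p) k (x ∷ a) (y ∷ b)
    back y = let x , similar′ = extend-position b a (Similar-sym a b similar) y
             in x , similar⇒dupWins k (x ∷ a) (y ∷ b) (Similar-sym (y ∷ b) (x ∷ a) similar′)

lemma12 : (k n p : ℕ) → 3 ^ k ≤ n → 3 ^ k ≤ p → 𝔄⁺ n ≡[ k ] 𝔄⁺ p
lemma12 k n p 3ᵏ≤n 3ᵏ≤p = similar⇒dupWins k [] [] initial
  where
    initial : Similar {n} {0} {p} (3 ^ k) [] []
    initial [] = inj₂ ( subst (3 ^ k ≤_) (sym (count-const [])) 3ᵏ≤n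
                      , subst (3 ^ k ≤_) (sym (count-const [])) 3ᵏ≤p )
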